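{- Let $\mathbb{G}_1$ be any graph and $\mathbb{G}_2$ be a non-compliant graph. Let $\mathbb{H}$ be the corona of $\mathbb{G}_1$ and $\mathbb{G}_2$. Then, $\mathbb{H}$ is compliant and $_{\mathbb{H}}d_{td}(b_{ij})\leq 2+(n-1)\gamma_t(\mathbb{G}_2),$ $i=1,2,...,n \text{ and } j=1,2,...,m.$
   Context: $\mathbb{G}_1$ has vertices $a_1,\dots,a_n$ and $\mathbb{G}_2$ has vertices $b_1,\dots,b_m$. The corona $\mathbb{H}=\mathbb{G}_1\odot\mathbb{G}_2$ is obtained by taking $n$ copies of $\mathbb{G}_2$, with vertices $b_{i1},\dots,b_{im}$ in the $i$-th copy, and joining $a_i$ to every vertex of the $i$-th copy. A total dominating set (TDS) is a vertex set $S$ such that every vertex is adjacent to a vertex of $S$; a minimal TDS (MTDS) has no proper subset that is a TDS; $\gamma_t$ is the minimum TDS cardinality. A vertex is compliant if some MTDS contains it; a graph is compliant if all its vertices are, non-compliant otherwise. For compliant $\mathbb{X}$, $_{\mathbb{X}}d_{td}(a)=\min\{|S| : S \text{ an MTDS of } \mathbb{X} \text{ containing } a\}$. -}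

module Defs where

open import Data.Nat using (ℕ; _+_; _*_; _≤_)
open import Data.Bool using (Bool; true; false; _∧_)
open import Data.Bool.Properties using (∧-comm)
open import Data.Fin using (Fin; splitAt; remQuot; combine; _↑ˡ_; _↑ʳ_)
open import Data.Fin.Properties using (_≟_)
open import Data.Fin.Subset using (Subset; _∈_; _⊂_; ∣_∣)
open import Data.Sum using (_⊎_; inj₁; inj₂)
open import Data.Product using (Σ; ∃; _×_; _,_; proj₁)
open import Relation.Nullary using (¬_; yes; no)
open import Relation.Nullary.Decidable using (⌊_⌋)
open import Relation.Binary.PropositionalEquality using (_≡_; refl; sym)

record Graph (n : ℕ) : Set where
  field
    adj    : Fin n → Fin n → Bool
    symm   : ∀ u v → adj u v ≡ adj v u
    irrefl : ∀ v → adj v v ≡ false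
open Graph public

IsTDS : ∀ {n} → Graph n → Subset n → Set
IsTDS {n} G S = ∀ (v : Fin n) → ∃ λ (u : Fin n) → u ∈ S × adj G v u ≡ true

IsMTDS : ∀ {n} → Graph n → Subset n → Set
IsMTDS G S = IsTDS G S × (∀ T → T ⊂ S → ¬ IsTDS G T)

CompliantVertex : ∀ {n} → Graph n → Fin n → Set
CompliantVertex G v = ∃ λ S → IsMTDS G S × v ∈ S

Compliant : ∀ {n} → Graph n → Set
Compliant {n} G = ∀ (v : Fin n) → CompliantVertex G v

NonCompliant : ∀ {n} → Graph n → Set
NonCompliant G = ¬ Compliant G

IsGammaT : ∀ {n} → Graph n → ℕ → Set
IsGammaT G k = (∃ λ S → IsTDS G S × ∣ S ∣ ≡ k) × (∀ S → IsTDS G S → k ≤ ∣ S ∣)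

IsDtd : ∀ {n} → Graph n → Fin n → ℕ → Set
IsDtd X a d =
  (∃ λ S → IsMTDS X S × a ∈ S × ∣ S ∣ ≡ d) ×
  (∀ S → IsMTDS X S → a ∈ S → d ≤ ∣ S ∣)

-- Corona G₁ ⊙ G₂ on Fin (n + n * m).
-- a_i  = i ↑ˡ (n * m);   b_ij = n ↑ʳ combine i j.

eqb : ∀ {n} → Fin n → Fin n → Bool
eqb i k = ⌊ i ≟ k ⌋

eqb-sym : ∀ {n} (i k : Fin n) → eqb i k ≡ eqb k i
eqb-sym i k with i ≟ k | k ≟ i
... | yes _ | yes _ = refl
... | no _  | no _  = refl
... | yes p | no ¬q = Data.Empty.⊥-elim (¬q (sym p))
  where import Data.Empty
... | no ¬p | yes q = Data.Empty.⊥-elim (¬p (sym q))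
  where import Data.Empty

eqb-refl : ∀ {n} (i : Fin n) → eqb i i ≡ true
eqb-refl i with i ≟ i
... | yes _ = refl
... | no ¬p = Data.Empty.⊥-elim (¬p refl)
  where import Data.Empty

module _ {n m : ℕ} (G₁ : Graph n) (G₂ : Graph m) where

  bb : Fin n × Fin m → Fin n × Fin m → Bool
  bb (i , j) (k , l) = eqb i k ∧ adj G₂ j l

  bb-sym : ∀ x y → bb x y ≡ bb y x
  bb-sym (i , j) (k , l) rewrite eqb-sym i k | symm G₂ j l = refl

  bb-irrefl : ∀ x → bb x x ≡ false
  bb-irrefl (i , j) rewrite eqb-refl i | irrefl G₂ j = refl

  coronaAdjS : Fin n ⊎ Fin (n * m) → Fin n ⊎ Fin (n * m) → Bool
  coronaAdjS (inj₁ i) (inj₁ k) = adj G₁ i k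
  coronaAdjS (inj₁ i) (inj₂ q) = eqb i (proj₁ (remQuot {n} m q))
  coronaAdjS (inj₂ p) (inj₁ k) = eqb k (proj₁ (remQuot {n} m p))
  coronaAdjS (inj₂ p) (inj₂ q) = bb (remQuot {n} m p) (remQuot {n} m q)

  coronaAdjS-sym : ∀ x y → coronaAdjS x y ≡ coronaAdjS y x
  coronaAdjS-sym (inj₁ i) (inj₁ k) = symm G₁ i k
  coronaAdjS-sym (inj₁ i) (inj₂ q) = refl
  coronaAdjS-sym (inj₂ p) (inj₁ k) = refl
  coronaAdjS-sym (inj₂ p) (inj₂ q) = bb-sym (remQuot {n} m p) (remQuot {n} m q)

  coronaAdjS-irrefl : ∀ x → coronaAdjS x x ≡ false
  coronaAdjS-irrefl (inj₁ i) = irrefl G₁ i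
  coronaAdjS-irrefl (inj₂ p) = bb-irrefl (remQuot {n} m p)

  corona : Graph (n + n * m)
  corona = record
    { adj    = λ x y → coronaAdjS (splitAt n x) (splitAt n y)
    ; symm   = λ x y → coronaAdjS-sym (splitAt n x) (splitAt n y)
    ; irrefl = λ x → coronaAdjS-irrefl (splitAt n x)
    }

aV : ∀ {n} m → Fin n → Fin (n + n * m)
aV {n} m i = i ↑ˡ (n * m)

bV : ∀ {n m} → Fin n → Fin m → Fin (n + n * m)
bV {n} i j = n ↑ʳ combine i j

-- Let D be a minimum total dominating set of G₂; being minimum, it is minimal. For a hub
-- aᵢ and a leaf bᵢⱼ of the corona take S = {aᵢ, bᵢⱼ} ∪ ⋃_{k ≠ i} Dₖ, where Dₖ is the copy
-- of D among the leaves of aₖ. S totally dominates the corona, and it is minimal: aᵢ and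
-- bᵢⱼ are each other's only neighbours in S, so every TDS T ⊆ S contains both, and since
-- aₖ ∉ S for k ≠ i, the leaves of aₖ in T totally dominate G₂ inside D, hence are all of
-- D. So every vertex lies in an MTDS, and d_td(bᵢⱼ) ≤ |S| = 2 + (n - 1) γ_t(G₂); the
-- minimum defining d_td exists because "some MTDS containing bᵢⱼ has d elements" is
-- decidable. Non-compliance of G₂ is only used to know that G₂ has a vertex.
module Submission where

open import Defs
open import Data.Nat using (ℕ; _+_; _*_; _∸_; _≤_)
open import Data.Fin using (Fin)
open import Data.Product using (∃; _×_)

open import Algebra.Properties.CommutativeSemigroup using (x∙yz≈y∙xz)
open import Data.Bool using (true; _∧_)
open import Data.Empty using (⊥-elim)
open import Data.Fin using (zero; suc; splitAt; join; combine; _↑ʳ_)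
open import Data.Fin.Properties using (_≟_; all?; any?; splitAt-↑ˡ; splitAt-↑ʳ; join-splitAt; remQuot-combine; combine-remQuot)
open import Data.Fin.Subset using (Subset; inside; outside; _∈_; _∉_; _⊆_; _⊂_; ⁅_⁆; ∣_∣)
open import Data.Fin.Subset.Properties using (_∈?_; _⊂?_; anySubset?; x∈⁅x⁆; x∈⁅y⁆⇒x≡y; ∣⁅x⁆∣≡1; p⊂q⇒∣p∣<∣q∣)
open import Data.Nat using (zero; suc; _<_)
open import Data.Nat.Properties using (+-commutativeSemigroup; <⇒≱; ≮⇒≥; n<1+n; m<1+n⇒m<n∨m≡n)
import Data.Nat.Properties as ℕ
import Data.Bool.Properties as Bool
open import Data.Product using (_,_; proj₁)
open import Data.Sum using (_⊎_; inj₁; inj₂; [_,_]′)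
open import Data.Vec using (Vec; []; _∷_; _++_; concat; replicate; lookup; tabulate; _[_]≔_)
open import Data.Vec.Properties using ([]=⇒lookup; lookup⇒[]=; lookup-++ˡ; lookup-++ʳ; lookup-concat; lookup∘update; lookup∘update′; lookup-replicate; lookup∘tabulate)
open import Function using (_∘_; case_of_)
open import Relation.Nullary using (yes; no; ¬_)
open import Relation.Nullary.Decidable using (_×-dec_; ¬?; map′)
open import Relation.Unary using (Decidable)
open import Relation.Binary.PropositionalEquality using (_≡_; _≢_; refl; sym; trans; cong; cong₂; subst; module ≡-Reasoning)

∣p++q∣≡∣p∣+∣q∣ : ∀ {a b} (p : Subset a) (q : Subset b) → ∣ p ++ q ∣ ≡ ∣ p ∣ + ∣ q ∣
∣p++q∣≡∣p∣+∣q∣ []            q = refl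
∣p++q∣≡∣p∣+∣q∣ (inside  ∷ p) q = cong suc (∣p++q∣≡∣p∣+∣q∣ p q)
∣p++q∣≡∣p∣+∣q∣ (outside ∷ p) q = ∣p++q∣≡∣p∣+∣q∣ p q

∣concat-replicate∣ : ∀ a {b} (D : Subset b) → ∣ concat (replicate a D) ∣ ≡ a * ∣ D ∣
∣concat-replicate∣ zero    D = refl
∣concat-replicate∣ (suc a) D =
  trans (∣p++q∣≡∣p∣+∣q∣ D _) (cong (∣ D ∣ +_) (∣concat-replicate∣ a D))

∣concat-replicate-[]≔∣ : ∀ {a b} (D E : Subset b) (i : Fin a) →
                         ∣ concat (replicate a D [ i ]≔ E) ∣ ≡ ∣ E ∣ + (a ∸ 1) * ∣ D ∣
∣concat-replicate-[]≔∣ {suc a} D E zero =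
  trans (∣p++q∣≡∣p∣+∣q∣ E _) (cong (∣ E ∣ +_) (∣concat-replicate∣ a D))
∣concat-replicate-[]≔∣ {suc (suc a)} D E (suc i) = begin
  ∣ D ++ concat (replicate (suc a) D [ i ]≔ E) ∣   ≡⟨ ∣p++q∣≡∣p∣+∣q∣ D _ ⟩
  ∣ D ∣ + ∣ concat (replicate (suc a) D [ i ]≔ E) ∣ ≡⟨ cong (∣ D ∣ +_) (∣concat-replicate-[]≔∣ D E i) ⟩
  ∣ D ∣ + (∣ E ∣ + a * ∣ D ∣)                       ≡⟨ x∙yz≈y∙xz +-commutativeSemigroup ∣ D ∣ ∣ E ∣ _ ⟩
  ∣ E ∣ + (∣ D ∣ + a * ∣ D ∣)                       ∎
  where open ≡-Reasoning

∈-transport : ∀ {a b} {p : Subset a} {q : Subset b} {x y} →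
              lookup p x ≡ lookup q y → x ∈ p → y ∈ q
∈-transport {q = q} {y = y} eq x∈p = lookup⇒[]= y q (trans (sym eq) ([]=⇒lookup x∈p))

eqb⇒≡ : ∀ {a} {k k' : Fin a} → eqb k k' ≡ true → k ≡ k'
eqb⇒≡ {k = k} {k'} e with k ≟ k' | e
... | yes k≡k' | _  = k≡k'
... | no _     | ()

∧≡true⇒ : ∀ {x y} → x ∧ y ≡ true → x ≡ true × y ≡ true
∧≡true⇒ {true} {true} _ = refl , refl

module Least {p} {P : ℕ → Set p} (P? : Decidable P) where

  IsLeast : ℕ → Set p
  IsLeast d = P d × (∀ {e} → P e → d ≤ e)

  leastBelow : ∀ k → (∃ IsLeast) ⊎ (∀ {e} → e < k → ¬ P e)
  leastBelow zero = inj₂ λ ()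
  leastBelow (suc k) with leastBelow k
  ... | inj₁ least = inj₁ least
  ... | inj₂ none with P? k
  ...   | yes pk  = inj₁ (k , pk , λ pe → ≮⇒≥ λ e<k → none e<k pe)
  ...   | no  ¬pk = inj₂ λ e<1+k pe →
    [ (λ e<k → none e<k pe) , (λ e≡k → ¬pk (subst P e≡k pe)) ]′ (m<1+n⇒m<n∨m≡n e<1+k)

  least : ∀ {k} → P k → ∃ λ d → IsLeast d × d ≤ k
  least {k} pk with leastBelow (suc k)
  ... | inj₁ (d , pd , d-min) = d , (pd , d-min) , d-min pk
  ... | inj₂ none             = ⊥-elim (none (n<1+n k) pk)

no-loop : ∀ {N} (G : Graph N) v → adj G v v ≢ true
no-loop G v v~v = case trans (sym (irrefl G v)) v~v of λ ()

NonCompliant⇒vertex : ∀ {N} (G : Graph N) → NonCompliant G → Fin N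
NonCompliant⇒vertex {zero}  G nc = ⊥-elim (nc λ ())
NonCompliant⇒vertex {suc N} G nc = zero

module _ {N} (G : Graph N) where

  IsTDS? : Decidable (IsTDS G)
  IsTDS? S = all? λ v → any? λ u → (u ∈? S) ×-dec (adj G v u Bool.≟ true)

  IsMTDS? : Decidable (IsMTDS G)
  IsMTDS? S = IsTDS? S ×-dec
    map′ (λ ∄T T T⊂S T-tds → ∄T (T , T⊂S , T-tds)) (λ ∀T (T , T⊂S , T-tds) → ∀T T T⊂S T-tds)
         (¬? (anySubset? λ T → (T ⊂? S) ×-dec IsTDS? T))

  IsMTDS-intro : ∀ {S} → IsTDS G S → (∀ {T} → T ⊆ S → IsTDS G T → S ⊆ T) → IsMTDS G S
  IsMTDS-intro S-tds S-least =
    S-tds , λ T (T⊆S , x , x∈S , x∉T) T-tds → x∉T (S-least T⊆S T-tds x∈S)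

  TDS⊆MTDS⇒⊇ : ∀ {S T} → IsMTDS G S → T ⊆ S → IsTDS G T → S ⊆ T
  TDS⊆MTDS⇒⊇ {T = T} (_ , S-min) T⊆S T-tds {x} x∈S with x ∈? T
  ... | yes x∈T = x∈T
  ... | no  x∉T = ⊥-elim (S-min T (T⊆S , x , x∈S , x∉T) T-tds)

  sole-neighbour∈TDS : ∀ {S T w} → IsTDS G T → T ⊆ S → ∀ v →
                       (∀ {u} → u ∈ S → adj G v u ≡ true → u ≡ w) → w ∈ T
  sole-neighbour∈TDS {T = T} T-tds T⊆S v sole with T-tds v
  ... | u , u∈T , v~u = subst (_∈ T) (sole (T⊆S u∈T) v~u) u∈T

  minimumTDS⇒MTDS : ∀ {g} → IsGammaT G g → ∃ λ D → IsMTDS G D × ∣ D ∣ ≡ g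
  minimumTDS⇒MTDS ((D , D-tds , ∣D∣≡g) , g-min) = D , (D-tds , D-min) , ∣D∣≡g
    where
    D-min : ∀ T → T ⊂ D → ¬ IsTDS G T
    D-min T T⊂D T-tds = <⇒≱ (subst (∣ T ∣ <_) ∣D∣≡g (p⊂q⇒∣p∣<∣q∣ T⊂D)) (g-min T T-tds)

  MTDS⇒IsDtd≤ : ∀ {a S} → IsMTDS G S → a ∈ S → ∃ λ d → IsDtd G a d × d ≤ ∣ S ∣
  MTDS⇒IsDtd≤ {a} {S} S-mtds a∈S with least (S , S-mtds , a∈S , refl)
    where
    P : ℕ → Set
    P d = ∃ λ T → IsMTDS G T × a ∈ T × ∣ T ∣ ≡ d
    P? : Decidable P
    P? d = anySubset? λ T → IsMTDS? T ×-dec (a ∈? T) ×-dec (∣ T ∣ ℕ.≟ d)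
    open Least P?
  ... | d , (pd , d-min) , d≤∣S∣ =
    d , (pd , λ T T-mtds a∈T → d-min (T , T-mtds , a∈T , refl)) , d≤∣S∣

module Corona {n m} (G₁ : Graph n) (G₂ : Graph m) where

  H : Graph (n + n * m)
  H = corona G₁ G₂

  data Vertex : Fin (n + n * m) → Set where
    hub  : (k : Fin n) → Vertex (aV m k)
    leaf : (k : Fin n) (l : Fin m) → Vertex (bV k l)

  vertex : ∀ x → Vertex x
  vertex x = subst Vertex (join-splitAt n (n * m) x) (fromSplit (splitAt n x))
    where
    fromSplit : ∀ s → Vertex (join n (n * m) s)
    fromSplit (inj₁ k) = hub k
    fromSplit (inj₂ p) = subst (Vertex ∘ (n ↑ʳ_)) (combine-remQuot {n} m p) (leaf _ _)

  hub~leaf : ∀ k k' l → adj H (aV m k) (bV k' l) ≡ eqb k k'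
  hub~leaf k k' l rewrite splitAt-↑ˡ n k (n * m) | splitAt-↑ʳ n (n * m) (combine k' l) =
    cong (eqb k ∘ proj₁) (remQuot-combine k' l)

  leaf~leaf : ∀ k l k' l' → adj H (bV k l) (bV k' l') ≡ eqb k k' ∧ adj G₂ l l'
  leaf~leaf k l k' l' = trans
    (cong₂ (coronaAdjS G₁ G₂) (splitAt-↑ʳ n (n * m) (combine k l))
                              (splitAt-↑ʳ n (n * m) (combine k' l')))
    (cong₂ (bb G₁ G₂) (remQuot-combine k l) (remQuot-combine k' l'))

  hub~own-leaf : ∀ k l → adj H (aV m k) (bV k l) ≡ true
  hub~own-leaf k l = trans (hub~leaf k k l) (eqb-refl k)

  leaf~own-hub : ∀ k l → adj H (bV k l) (aV m k) ≡ true
  leaf~own-hub k l = trans (symm H _ _) (hub~own-leaf k l)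

  leaf~leaf⁺ : ∀ {k l l'} → adj G₂ l l' ≡ true → adj H (bV k l) (bV k l') ≡ true
  leaf~leaf⁺ {k} {l} {l'} l~l' = trans (leaf~leaf k l k l') (cong₂ _∧_ (eqb-refl k) l~l')

  hub~leaf⁻ : ∀ {k k' l} → adj H (aV m k) (bV k' l) ≡ true → k ≡ k'
  hub~leaf⁻ {k} {k'} {l} e = eqb⇒≡ (trans (sym (hub~leaf k k' l)) e)

  leaf~hub⁻ : ∀ {k l k'} → adj H (bV k l) (aV m k') ≡ true → k' ≡ k
  leaf~hub⁻ e = hub~leaf⁻ (trans (symm H _ _) e)

  leaf~leaf⁻ : ∀ {k l k' l'} → adj H (bV k l) (bV k' l') ≡ true → k ≡ k' × adj G₂ l l' ≡ true
  leaf~leaf⁻ {k} {l} {k'} {l'} e with ∧≡true⇒ (trans (sym (leaf~leaf k l k' l')) e)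
  ... | k≡k' , l~l' = eqb⇒≡ k≡k' , l~l'

  _↾_ : Subset (n + n * m) → Fin n → Subset m
  T ↾ k = tabulate λ l → lookup T (bV k l)

  ∈↾⁺ : ∀ {T k l} → bV k l ∈ T → l ∈ T ↾ k
  ∈↾⁺ {T} {k} {l} = ∈-transport (sym (lookup∘tabulate (lookup T ∘ bV k) l))

  ∈↾⁻ : ∀ {T k l} → l ∈ T ↾ k → bV k l ∈ T
  ∈↾⁻ {T} {k} {l} = ∈-transport (lookup∘tabulate (lookup T ∘ bV k) l)

  ↾-TDS : ∀ {T} k → IsTDS H T → aV m k ∉ T → IsTDS G₂ (T ↾ k)
  ↾-TDS {T} k T-tds aₖ∉T l with T-tds (bV k l)
  ... | u , u∈T , bₖₗ~u = dominator (vertex u) u∈T bₖₗ~u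
    where
    dominator : ∀ {u} → Vertex u → u ∈ T → adj H (bV k l) u ≡ true →
                ∃ λ l' → l' ∈ T ↾ k × adj G₂ l l' ≡ true
    dominator (hub k') u∈T e with leaf~hub⁻ e
    ... | refl = ⊥-elim (aₖ∉T u∈T)
    dominator (leaf k' l') u∈T e with leaf~leaf⁻ e
    ... | refl , l~l' = l' , ∈↾⁺ u∈T , l~l'

  -- Vertex sets of the corona are laid out as the hubs followed by the n copies of G₂.
  module Through (D : Subset m) (i : Fin n) (j : Fin m) where

    copies : Vec (Subset m) n
    copies = replicate n D [ i ]≔ ⁅ j ⁆

    S : Subset (n + n * m)
    S = ⁅ i ⁆ ++ concat copies

    lookup-S-leaf : ∀ k l → lookup S (bV k l) ≡ lookup (lookup copies k) l
    lookup-S-leaf k l = trans (lookup-++ʳ ⁅ i ⁆ (concat copies) (combine k l)) (lookup-concat copies k l)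

    lookup-S-own-leaf : ∀ l → lookup S (bV i l) ≡ lookup ⁅ j ⁆ l
    lookup-S-own-leaf l =
      trans (lookup-S-leaf i l) (cong (λ B → lookup B l) (lookup∘update i (replicate n D) ⁅ j ⁆))

    lookup-S-other-leaf : ∀ {k} l → k ≢ i → lookup S (bV k l) ≡ lookup D l
    lookup-S-other-leaf {k} l k≢i = trans (lookup-S-leaf k l)
      (cong (λ B → lookup B l) (trans (lookup∘update′ k≢i (replicate n D) ⁅ j ⁆) (lookup-replicate k D)))

    hub∈S⇒≡ : ∀ {k} → aV m k ∈ S → k ≡ i
    hub∈S⇒≡ {k} = x∈⁅y⁆⇒x≡y i ∘ ∈-transport (lookup-++ˡ ⁅ i ⁆ (concat copies) k)

    aᵢ∈S : aV m i ∈ S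
    aᵢ∈S = ∈-transport (sym (lookup-++ˡ ⁅ i ⁆ (concat copies) i)) (x∈⁅x⁆ i)

    own-leaf∈S⇒≡ : ∀ {l} → bV i l ∈ S → l ≡ j
    own-leaf∈S⇒≡ {l} = x∈⁅y⁆⇒x≡y j ∘ ∈-transport (lookup-S-own-leaf l)

    bᵢⱼ∈S : bV i j ∈ S
    bᵢⱼ∈S = ∈-transport (sym (lookup-S-own-leaf j)) (x∈⁅x⁆ j)

    other-leaf∈S⁻ : ∀ {k l} → k ≢ i → bV k l ∈ S → l ∈ D
    other-leaf∈S⁻ {l = l} k≢i = ∈-transport (lookup-S-other-leaf l k≢i)

    other-leaf∈S⁺ : ∀ {k l} → k ≢ i → l ∈ D → bV k l ∈ S
    other-leaf∈S⁺ {l = l} k≢i = ∈-transport (sym (lookup-S-other-leaf l k≢i))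

    sole-neighbour-of-bᵢⱼ : ∀ {u} → u ∈ S → adj H (bV i j) u ≡ true → u ≡ aV m i
    sole-neighbour-of-bᵢⱼ = go (vertex _)
      where
      go : ∀ {u} → Vertex u → u ∈ S → adj H (bV i j) u ≡ true → u ≡ aV m i
      go (hub k) u∈S _ = cong (aV m) (hub∈S⇒≡ u∈S)
      go (leaf k l) u∈S e with leaf~leaf⁻ e
      ... | refl , j~l with own-leaf∈S⇒≡ u∈S
      ... | refl = ⊥-elim (no-loop G₂ j j~l)

    sole-neighbour-of-aᵢ : ∀ {u} → u ∈ S → adj H (aV m i) u ≡ true → u ≡ bV i j
    sole-neighbour-of-aᵢ = go (vertex _)
      where
      go : ∀ {u} → Vertex u → u ∈ S → adj H (aV m i) u ≡ true → u ≡ bV i j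
      go (hub k) u∈S e with hub∈S⇒≡ u∈S
      ... | refl = ⊥-elim (no-loop H (aV m i) e)
      go (leaf k l) u∈S e with hub~leaf⁻ e
      ... | refl = cong (bV i) (own-leaf∈S⇒≡ u∈S)

    S-TDS : IsTDS G₂ D → IsTDS H S
    S-TDS D-tds = dominator ∘ vertex
      where
      dominator : ∀ {x} → Vertex x → ∃ λ u → u ∈ S × adj H x u ≡ true
      dominator (hub k) with k ≟ i | D-tds j
      ... | yes refl | _           = bV i j , bᵢⱼ∈S , hub~own-leaf i j
      ... | no k≢i   | u , u∈D , _ = bV k u , other-leaf∈S⁺ k≢i u∈D , hub~own-leaf k u
      dominator (leaf k l) with k ≟ i | D-tds l
      ... | yes refl | _             = aV m i , aᵢ∈S , leaf~own-hub i l
      ... | no k≢i   | u , u∈D , l~u = bV k u , other-leaf∈S⁺ k≢i u∈D , leaf~leaf⁺ l~u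

    S-MTDS : IsMTDS G₂ D → IsMTDS H S
    S-MTDS D-mtds = IsMTDS-intro H (S-TDS (proj₁ D-mtds)) S-least
      where
      S-least : ∀ {T} → T ⊆ S → IsTDS H T → S ⊆ T
      S-least {T} T⊆S T-tds = go (vertex _)
        where
        go : ∀ {x} → Vertex x → x ∈ S → x ∈ T
        go (hub k) x∈S with hub∈S⇒≡ x∈S
        ... | refl = sole-neighbour∈TDS H T-tds T⊆S (bV i j) sole-neighbour-of-bᵢⱼ
        go (leaf k l) x∈S with k ≟ i
        ... | yes refl with own-leaf∈S⇒≡ x∈S
        ...   | refl = sole-neighbour∈TDS H T-tds T⊆S (aV m i) sole-neighbour-of-aᵢ
        go (leaf k l) x∈S | no k≢i =
          ∈↾⁻ (TDS⊆MTDS⇒⊇ G₂ D-mtds T↾k⊆D (↾-TDS k T-tds aₖ∉T) (other-leaf∈S⁻ k≢i x∈S))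
          where
          T↾k⊆D : T ↾ k ⊆ D
          T↾k⊆D = other-leaf∈S⁻ k≢i ∘ T⊆S ∘ ∈↾⁻
          aₖ∉T : aV m k ∉ T
          aₖ∉T = k≢i ∘ hub∈S⇒≡ ∘ T⊆S

    ∣S∣ : ∣ S ∣ ≡ 2 + (n ∸ 1) * ∣ D ∣
    ∣S∣ = begin
      ∣ S ∣                             ≡⟨ ∣p++q∣≡∣p∣+∣q∣ ⁅ i ⁆ (concat copies) ⟩
      ∣ ⁅ i ⁆ ∣ + ∣ concat copies ∣     ≡⟨ cong₂ _+_ (∣⁅x⁆∣≡1 i) (∣concat-replicate-[]≔∣ D ⁅ j ⁆ i) ⟩
      1 + (∣ ⁅ j ⁆ ∣ + (n ∸ 1) * ∣ D ∣) ≡⟨ cong (λ c → 1 + (c + (n ∸ 1) * ∣ D ∣)) (∣⁅x⁆∣≡1 j) ⟩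
      2 + (n ∸ 1) * ∣ D ∣               ∎
      where open ≡-Reasoning

theorem11 : ∀ {n m : ℕ} (G₁ : Graph n) (G₂ : Graph m) →
    NonCompliant G₂ →
    ∀ (g : ℕ) → IsGammaT G₂ g →
    Compliant (corona G₁ G₂) ×
    (∀ (i : Fin n) (j : Fin m) →
      ∃ λ d → IsDtd (corona G₁ G₂) (bV i j) d × d ≤ 2 + (n ∸ 1) * g)
theorem11 {n} {m} G₁ G₂ nc g γt with minimumTDS⇒MTDS G₂ γt
... | D , D-mtds , ∣D∣≡g = compliant , dtd-bound
  where
  open Corona G₁ G₂
  open Through D

  compliant : Compliant H
  compliant x with vertex x
  ... | hub k    = S k j₀ , S-MTDS k j₀ D-mtds , aᵢ∈S k j₀
    where
    j₀ : Fin m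
    j₀ = NonCompliant⇒vertex G₂ nc
  ... | leaf k l = S k l , S-MTDS k l D-mtds , bᵢⱼ∈S k l

  dtd-bound : ∀ i j → ∃ λ d → IsDtd H (bV i j) d × d ≤ 2 + (n ∸ 1) * g
  dtd-bound i j with MTDS⇒IsDtd≤ H (S-MTDS i j D-mtds) (bᵢⱼ∈S i j)
  ... | d , d-dtd , d≤∣S∣ =
    d , d-dtd , subst (d ≤_) (trans (∣S∣ i j) (cong (λ c → 2 + (n ∸ 1) * c) ∣D∣≡g)) d≤∣S∣
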